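{- For every integer $n\ge3$, $$H_{n-1}^3+H_{n-2}^2H_{n+1}+H_{n-3}H_n^2-2H_{n-2}H_{n-1}H_n-H_{n-3}H_{n-1}H_{n+1}=41.$$
   Context: The generalized Tribonacci sequence $(H_n)_{n\ge0}$ is defined by $H_0=3$, $H_1=0$, $H_2=2$ and $H_{n+2}=H_{n+1}+H_n+H_{n-1}$ for $n\ge1$. -}

module Defs where

open import Data.Integer using (ℤ; +_)
open import Data.Nat using (ℕ; zero; suc)

H : ℕ → ℤ
H zero = + 3
H (suc zero) = + 0
H (suc (suc zero)) = + 2
H (suc (suc (suc n))) = H (suc (suc n)) Data.Integer.+ H (suc n) Data.Integer.+ H n

module Submission where

-- The left-hand side of the theorem is the determinant
--   | H_{n-1} H_{n-2} H_{n-3} |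
--   | H_n     H_{n-1} H_{n-2} |
--   | H_{n+1} H_n     H_{n-1} |
-- of three consecutive windows of the sequence, written out as a cubic form
-- in five consecutive terms.  Shifting a Tribonacci-type sequence by one step
-- multiplies this matrix by the companion matrix of x³ - x² - x - 1, whose
-- determinant is 1, so the form is invariant under the shift.
--
-- Induction then shows
-- the form is constant, and for H its value at the start is 41.

open import Defs
open import Data.Nat using (ℕ; zero; suc; s≤s)
open import Data.Integer using (ℤ; +_; _+_; _-_; _*_)
open import Data.Integer.Tactic.RingSolver using (solve-∀)
open import Data.Nat.Properties using (+-comm)
open import Relation.Binary.PropositionalEquality
  using (_≡_; refl; cong; sym; module ≡-Reasoning)

-- The cubic form of the theorem, on five consecutive terms
-- x = s_{n-3}, y = s_{n-2}, z = s_{n-1}, u = s_n, v = s_{n+1}.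
windowForm : ℤ → ℤ → ℤ → ℤ → ℤ → ℤ
windowForm x y z u v =
  z * z * z + y * y * v + x * u * u - (+ 2) * y * z * u - x * z * v

IsTribonacci : (ℕ → ℤ) → Set
IsTribonacci s = ∀ m → s (suc (suc (suc m))) ≡ s (suc (suc m)) + s (suc m) + s m

windowAt : (ℕ → ℤ) → ℕ → ℤ
windowAt s m = windowForm (s m) (s (suc m)) (s (suc (suc m)))
                          (s (suc (suc (suc m)))) (s (suc (suc (suc (suc m)))))

seedForm : ℤ → ℤ → ℤ → ℤ
seedForm a b c = windowForm a b c d (d + c + b)
  where d = c + b + a

windowAt-seed : ∀ s → IsTribonacci s → ∀ m →
  windowAt s m ≡ seedForm (s m) (s (suc m)) (s (suc (suc m)))
windowAt-seed s rec m rewrite rec (suc m) | rec m = refl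

-- Shift invariance of the form: the companion matrix has determinant 1.
-- The ring solver needs the polynomial identity with seedForm unfolded;
-- d, e, f are the three terms following a, b, c.
seedForm-shift : ∀ a b c → seedForm b c (c + b + a) ≡ seedForm a b c
seedForm-shift = unfolded
  where
  unfolded : ∀ a b c →
    let d = c + b + a; e = d + c + b; f = e + d + c in
    d * d * d + c * c * f + b * e * e - (+ 2) * c * d * e - b * d * f
      ≡ c * c * c + b * b * e + a * d * d - (+ 2) * b * c * d - a * c * e
  unfolded = solve-∀

windowAt-step : ∀ s → IsTribonacci s → ∀ m → windowAt s (suc m) ≡ windowAt s m
windowAt-step s rec m = begin
  windowAt s (suc m)
    ≡⟨ windowAt-seed s rec (suc m) ⟩
  seedForm (s (suc m)) (s (suc (suc m))) (s (suc (suc (suc m))))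
    ≡⟨ cong (seedForm (s (suc m)) (s (suc (suc m)))) (rec m) ⟩
  seedForm (s (suc m)) (s (suc (suc m))) (s (suc (suc m)) + s (suc m) + s m)
    ≡⟨ seedForm-shift (s m) (s (suc m)) (s (suc (suc m))) ⟩
  seedForm (s m) (s (suc m)) (s (suc (suc m)))
    ≡⟨ sym (windowAt-seed s rec m) ⟩
  windowAt s m ∎
  where open ≡-Reasoning

windowAt-constant : ∀ s → IsTribonacci s → ∀ m → windowAt s m ≡ windowAt s 0
windowAt-constant s rec zero = refl
windowAt-constant s rec (suc m) = begin
  windowAt s (suc m) ≡⟨ windowAt-step s rec m ⟩
  windowAt s m       ≡⟨ windowAt-constant s rec m ⟩
  windowAt s 0       ∎
  where open ≡-Reasoning

H-isTribonacci : IsTribonacci H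
H-isTribonacci m = refl

-- For n = m + 3 the left-hand side is windowAt H m, and windowAt H 0 = 41
-- (computed from H_0, …, H_4 = 3, 0, 2, 5, 7).
theorem2p5 : (n : ℕ) → n Data.Nat.≥ 3 →
    H (n Data.Nat.∸ 1) * H (n Data.Nat.∸ 1) * H (n Data.Nat.∸ 1)
    + H (n Data.Nat.∸ 2) * H (n Data.Nat.∸ 2) * H (n Data.Nat.+ 1)
    + H (n Data.Nat.∸ 3) * H n * H n
    - (+ 2) * H (n Data.Nat.∸ 2) * H (n Data.Nat.∸ 1) * H n
    - H (n Data.Nat.∸ 3) * H (n Data.Nat.∸ 1) * H (n Data.Nat.+ 1)
    ≡ + 41
theorem2p5 (suc (suc (suc m))) (s≤s (s≤s (s≤s _)))
  rewrite +-comm m 1 = windowAt-constant H H-isTribonacci m
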